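{- Let $k\ge 2$, $p = \frac{k-1}{k}$ and $\epsilon > 0$. Then with probability tending to one as $n \to \infty$, \[ \left| |A^{(k)}_n| - p \binom{n}{k} \right| < \epsilon n^k. \]
   Context: For $k\ge2$, $A^{(k)}_n$ is the random $k$-graph on an $n$-element vertex set $V$ defined as follows: choose a uniformly random function $f:\binom{V}{k-1}\to\{0,1,\dots,k-1\}$ (independent uniform colors on all $(k-1)$-subsets), and let $E\in\binom{V}{k}$ be an edge if and only if $\sum_{T\subseteq E, |T|=k-1} f(T)\not\equiv 0 \pmod k$. $|A^{(k)}_n|$ denotes its number of edges.
   Formalization: The parameter ε and the allowed shortfall of the probability from one both range over the positive rationals. -}

module Defs where

open import Data.Nat using (ℕ; zero; suc; _+_; _*_; _∸_; _^_; _≤_; NonZero; s≤s)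
open import Data.Nat.DivMod using (_%_)
open import Data.Fin using (Fin; toℕ)
open import Data.Fin.Subset using (Subset; _⊆_; ∣_∣; inside; outside)
open import Data.Fin.Subset.Properties using (_⊆?_)
open import Data.List using (List; []; _∷_; _++_; map; filter; length; concatMap; allFin; lookup)
open import Data.Nat.ListAction using (sum)
open import Data.Vec using (Vec; []; _∷_)
open import Data.Integer using (+_)
import Data.Rational as ℚ
open ℚ using (ℚ)
open import Relation.Nullary.Decidable using (⌊_⌋; ¬?)
open import Data.Nat.Properties using (_≟_)
open import Data.Bool using (if_then_else_)
open import Data.Nat.Combinatorics using (_C_)

ℕ→ℚ : ℕ → ℚ
ℕ→ℚ m = (+ m) ℚ./ 1

allSubsets : (n : ℕ) → List (Subset n)
allSubsets zero    = [] ∷ []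
allSubsets (suc n) = map (inside ∷_) (allSubsets n) ++ map (outside ∷_) (allSubsets n)

kSubsets : (n j : ℕ) → List (Subset n)
kSubsets n j = filter (λ s → ∣ s ∣ ≟ j) (allSubsets n)

allVecs : (k m : ℕ) → List (Vec (Fin k) m)
allVecs k zero    = [] ∷ []
allVecs k (suc m) = concatMap (λ c → map (c ∷_) (allVecs k m)) (allFin k)

Tsets : (k n : ℕ) → List (Subset n)
Tsets k n = kSubsets n (k ∸ 1)

-- a coloring f : ([n] choose k-1) → {0,…,k-1}, as a vector indexed by the list Tsets k n
Coloring : (k n : ℕ) → Set
Coloring k n = Vec (Fin k) (length (Tsets k n))

-- all colorings (the uniform sample space)
allColorings : (k n : ℕ) → List (Coloring k n)
allColorings k n = allVecs k (length (Tsets k n))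

colorSum : (k n : ℕ) → Coloring k n → Subset n → ℕ
colorSum k n f E =
  sum (map (λ i → if ⌊ lookup (Tsets k n) i ⊆? E ⌋ then toℕ (Data.Vec.lookup f i) else 0)
           (allFin (length (Tsets k n))))

numEdges : (k n : ℕ) .{{_ : NonZero k}} → Coloring k n → ℕ
numEdges k n f = length (filter (λ E → ¬? (colorSum k n f E % k ≟ 0)) (kSubsets n k))

pk : (k : ℕ) .{{_ : NonZero k}} → ℚ
pk k = (+ (k ∸ 1)) ℚ./ k

-- number of colorings in the event (i.e. k^{(n choose k-1)} times its probability)
goodCount : (k n : ℕ) .{{_ : NonZero k}} → ℚ → ℕ
goodCount k n ε = length (filter (λ f → ℚ.∣ ℕ→ℚ (numEdges k n f) ℚ.- pk k ℚ.* ℕ→ℚ (n C k) ∣ ℚ.<? ε ℚ.* ℕ→ℚ (n ^ k)) (allColorings k n))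

-- Pr[event] ≥ 1 - δ, written as (1 - δ) · #colorings ≤ #good colorings
ProbAtLeast : (k n : ℕ) .{{_ : NonZero k}} → (ε δ : ℚ) → Set
ProbAtLeast k n ε δ = (ℚ.1ℚ ℚ.- δ) ℚ.* ℕ→ℚ (length (allColorings k n)) ℚ.≤ ℕ→ℚ (goodCount k n ε)

≥2⇒NonZero : {k : ℕ} → 2 ≤ k → NonZero k
≥2⇒NonZero (s≤s _) = _

module Submission where

-- For k = K + 1 and a k-set E, let Z_E = k·[E is an edge] − K: the centred edge indicator.
-- Its sum Y = Σ_E Z_E equals k·|A| − K·C(n,k) = k·(|A| − p·C(n,k)).  Two facts drive the proof.
--   * Z_E has mean zero even conditionally on all other colours: the colour sum of E, as the
--     colour of one (k−1)-subset T of E varies uniformly, runs through all residues mod k.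
--   * Distinct k-sets E, E' are orthogonal: some (k−1)-subset T of E is not inside E', so
--     averaging over the colour of T kills Z_E while leaving Z_E' untouched.
-- Hence E[Y²] = Σ_E E[Z_E²] ≤ C(n,k)·K², and Chebyshev's inequality bounds the fraction of
-- colourings with | |A| − p C(n,k) | ≥ ε n^k by K²C(n,k)/(kεn^k)² ≤ 1/(ε² n^k) ≤ δ for large n.
--
-- Probabilities are counted
-- exactly: the uniform sample space is the list of all colourings.

open import Data.Nat as ℕ using (ℕ; zero; suc; NonZero; _≤_; z≤n; s≤s; _^_)
import Data.Nat.Properties as ℕP
open import Data.Nat.DivMod using (_%_; m<n⇒m%n≡m; [m+n]%n≡m%n)
open import Data.Nat.ListAction using (sum)
open import Data.Integer as ℤ using (ℤ; +_; 0ℤ; 1ℤ; -_; +≤+)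
import Data.Integer.Properties as ℤP
open import Data.Integer.Tactic.RingSolver using (solve-∀)
open import Data.Nat.Tactic.RingSolver using () renaming (solve-∀ to solve-∀ℕ)
import Data.Rational as ℚ
open ℚ using (ℚ; Positive; mkℚ)
import Data.Rational.Properties as ℚP
open import Data.Rational.Solver using (module +-*-Solver)
import Data.Rational.Unnormalised as U
open U using (mkℚᵘ; *≡*; *≤*)
import Data.Rational.Unnormalised.Properties as UP
open import Algebra.Properties.AbelianGroup ℤP.+-0-abelianGroup using (∙-cancelʳ)
open import Data.Nat.Combinatorics using (_C_; nCk+nC[k+1]≡[n+1]C[k+1])
open import Data.Fin using (Fin; toℕ; zero; suc)
import Data.Fin.Properties as FinP
open import Data.Fin.Subset using (Subset; _⊆_; ∣_∣; inside; outside; _∈_; _∉_)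
open import Data.Fin.Subset.Properties using (_⊆?_; ⊆-antisym; drop-there; in⊆in; out⊆; s⊆s)
open import Data.List using (List; []; _∷_; _++_; map; concatMap; allFin; length; filter; lookup)
import Data.List.Properties as ListP
open import Data.List.Membership.Propositional using () renaming (_∈_ to _∈ₗ_)
open import Data.List.Membership.Propositional.Properties
  using (∈-++⁺ˡ; ∈-++⁺ʳ; ∈-map⁺; ∈-map⁻; ∈-filter⁺; ∈-filter⁻)
open import Data.List.Relation.Unary.All as All using (All; []; _∷_)
open import Data.List.Relation.Unary.AllPairs using ([]; _∷_)
open import Data.List.Relation.Unary.Any as Any using (here; there)
open import Data.List.Relation.Unary.Any.Properties using (lookup-index)
open import Data.List.Relation.Unary.Unique.Propositional using (Unique)
import Data.List.Relation.Unary.Unique.Propositional.Properties as UniqueP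
open import Data.Vec as Vec using (Vec; []; _∷_; here; there)
open import Data.Bool using (Bool; true; false; if_then_else_)
open import Data.Product using (∃; _×_; _,_; proj₁; proj₂)
open import Data.Empty using (⊥-elim)
open import Relation.Nullary using (¬_; Dec; yes; no; does; ¬?; contradiction)
open import Relation.Nullary.Decidable using (⌊_⌋; isYes≗does; dec-true; dec-false)
open import Relation.Unary using (Decidable)
open import Function using (_∘_; id)
open import Relation.Binary.PropositionalEquality
open import Defs

∑ : {A : Set} → List A → (A → ℤ) → ℤ
∑ []       F = 0ℤ
∑ (x ∷ xs) F = F x ℤ.+ ∑ xs F

module _ {A : Set} where

  ∑-cong : (xs : List A) {F G : A → ℤ} → (∀ x → F x ≡ G x) → ∑ xs F ≡ ∑ xs G
  ∑-cong []       F≗G = refl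
  ∑-cong (x ∷ xs) F≗G = cong₂ ℤ._+_ (F≗G x) (∑-cong xs F≗G)

  ∑-zero : {xs : List A} {F : A → ℤ} → All (λ x → F x ≡ 0ℤ) xs → ∑ xs F ≡ 0ℤ
  ∑-zero []             = refl
  ∑-zero (Fx≡0 ∷ rest) = cong₂ ℤ._+_ Fx≡0 (∑-zero rest)

  ∑-++ : (xs ys : List A) (F : A → ℤ) → ∑ (xs ++ ys) F ≡ ∑ xs F ℤ.+ ∑ ys F
  ∑-++ []       ys F = sym (ℤP.+-identityˡ _)
  ∑-++ (x ∷ xs) ys F = trans (cong (ℤ._+_ (F x)) (∑-++ xs ys F)) (sym (ℤP.+-assoc (F x) _ _))

  ∑-+ : (xs : List A) (F G : A → ℤ) → ∑ xs (λ x → F x ℤ.+ G x) ≡ ∑ xs F ℤ.+ ∑ xs G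
  ∑-+ []       F G = refl
  ∑-+ (x ∷ xs) F G = trans (cong (ℤ._+_ (F x ℤ.+ G x)) (∑-+ xs F G)) (interchange (F x) (G x) _ _)
    where
    interchange : ∀ a b c d → a ℤ.+ b ℤ.+ (c ℤ.+ d) ≡ a ℤ.+ c ℤ.+ (b ℤ.+ d)
    interchange = solve-∀

  ∑-*ˡ : (xs : List A) (c : ℤ) (F : A → ℤ) → ∑ xs (λ x → c ℤ.* F x) ≡ c ℤ.* ∑ xs F
  ∑-*ˡ []       c F = sym (ℤP.*-zeroʳ c)
  ∑-*ˡ (x ∷ xs) c F = trans (cong (ℤ._+_ (c ℤ.* F x)) (∑-*ˡ xs c F)) (sym (ℤP.*-distribˡ-+ c (F x) _))

  ∑-*ʳ : (xs : List A) (c : ℤ) (F : A → ℤ) → ∑ xs (λ x → F x ℤ.* c) ≡ ∑ xs F ℤ.* c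
  ∑-*ʳ xs c F = begin
    ∑ xs (λ x → F x ℤ.* c) ≡⟨ ∑-cong xs (λ x → ℤP.*-comm (F x) c) ⟩
    ∑ xs (λ x → c ℤ.* F x) ≡⟨ ∑-*ˡ xs c F ⟩
    c ℤ.* ∑ xs F           ≡⟨ ℤP.*-comm c _ ⟩
    ∑ xs F ℤ.* c           ∎
    where open ≡-Reasoning

  ∑-mono : (xs : List A) {F G : A → ℤ} → (∀ x → F x ℤ.≤ G x) → ∑ xs F ℤ.≤ ∑ xs G
  ∑-mono []       F≤G = ℤP.≤-refl
  ∑-mono (x ∷ xs) F≤G = ℤP.+-mono-≤ (F≤G x) (∑-mono xs F≤G)

  ∑-const : (xs : List A) (c : ℤ) → ∑ xs (λ _ → c) ≡ + length xs ℤ.* c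
  ∑-const []       c = sym (ℤP.*-zeroˡ c)
  ∑-const (x ∷ xs) c = begin
    c ℤ.+ ∑ xs (λ _ → c)          ≡⟨ cong₂ ℤ._+_ (sym (ℤP.*-identityˡ c)) (∑-const xs c) ⟩
    1ℤ ℤ.* c ℤ.+ + length xs ℤ.* c ≡⟨ sym (ℤP.*-distribʳ-+ c 1ℤ (+ length xs)) ⟩
    + suc (length xs) ℤ.* c        ∎
    where open ≡-Reasoning

module _ {A B : Set} where

  ∑-map : (g : A → B) (xs : List A) (F : B → ℤ) → ∑ (map g xs) F ≡ ∑ xs (F ∘ g)
  ∑-map g []       F = refl
  ∑-map g (x ∷ xs) F = cong (ℤ._+_ (F (g x))) (∑-map g xs F)

  ∑-concatMap : (h : A → List B) (xs : List A) (F : B → ℤ) →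
    ∑ (concatMap h xs) F ≡ ∑ xs (λ x → ∑ (h x) F)
  ∑-concatMap h []       F = refl
  ∑-concatMap h (x ∷ xs) F =
    trans (∑-++ (h x) (concatMap h xs) F) (cong (ℤ._+_ (∑ (h x) F)) (∑-concatMap h xs F))

  ∑-swap : (xs : List A) (ys : List B) (F : A → B → ℤ) →
    ∑ xs (λ x → ∑ ys (F x)) ≡ ∑ ys (λ y → ∑ xs (λ x → F x y))
  ∑-swap []       ys F = sym (∑-zero (All.universal (λ _ → refl) ys))
  ∑-swap (x ∷ xs) ys F =
    trans (cong (ℤ._+_ (∑ ys (F x))) (∑-swap xs ys F)) (sym (∑-+ ys (F x) (λ y → ∑ xs (λ x → F x y))))

∑-allFin-suc : ∀ n (F : Fin (suc n) → ℤ) → ∑ (allFin (suc n)) F ≡ F zero ℤ.+ ∑ (allFin n) (F ∘ suc)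
∑-allFin-suc n F = cong (ℤ._+_ (F zero))
  (trans (cong (λ xs → ∑ xs F) (sym (ListP.map-tabulate id suc))) (∑-map suc (allFin n) F))

∑-shift : ∀ n (G : ℕ → ℤ) →
  ∑ (allFin n) (λ c → G (suc (toℕ c))) ℤ.+ G 0 ≡ ∑ (allFin n) (λ c → G (toℕ c)) ℤ.+ G n
∑-shift zero    G = refl
∑-shift (suc n) G = begin
  ∑ (allFin (suc n)) (λ c → G (suc (toℕ c))) ℤ.+ G 0
    ≡⟨ cong (ℤ._+ G 0) (∑-allFin-suc n (λ c → G (suc (toℕ c)))) ⟩
  (G 1 ℤ.+ S₂) ℤ.+ G 0      ≡⟨ cong (ℤ._+ G 0) (ℤP.+-comm (G 1) S₂) ⟩
  (S₂ ℤ.+ G 1) ℤ.+ G 0      ≡⟨ cong (ℤ._+ G 0) (∑-shift n (G ∘ suc)) ⟩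
  (S₁ ℤ.+ G (suc n)) ℤ.+ G 0 ≡⟨ rotate S₁ (G (suc n)) (G 0) ⟩
  (G 0 ℤ.+ S₁) ℤ.+ G (suc n)
    ≡⟨ cong (ℤ._+ G (suc n)) (sym (∑-allFin-suc n (λ c → G (toℕ c)))) ⟩
  ∑ (allFin (suc n)) (λ c → G (toℕ c)) ℤ.+ G (suc n) ∎
  where
  S₁ S₂ : ℤ
  S₁ = ∑ (allFin n) (λ c → G (suc (toℕ c)))
  S₂ = ∑ (allFin n) (λ c → G (suc (suc (toℕ c))))
  rotate : ∀ a b c → (a ℤ.+ b) ℤ.+ c ≡ (c ℤ.+ a) ℤ.+ b
  rotate = solve-∀
  open ≡-Reasoning

-- φ is k-balanced when the values of φ on any k consecutive integers sum to zero;
-- then φ of a uniformly random colour in Fin k, shifted by anything, has mean zero.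
Balanced : ℕ → (ℕ → ℤ) → Set
Balanced k φ = ∀ s → ∑ (allFin k) (λ c → φ (toℕ c ℕ.+ s)) ≡ 0ℤ

periodic-balanced : ∀ k (H : ℕ → ℤ) → (∀ s → H (k ℕ.+ s) ≡ H s) →
  ∑ (allFin k) (λ c → H (toℕ c)) ≡ 0ℤ → Balanced k H
periodic-balanced k H period zero-sum zero =
  trans (∑-cong (allFin k) (λ c → cong H (ℕP.+-identityʳ (toℕ c)))) zero-sum
periodic-balanced k H period zero-sum (suc s) = ∙-cancelʳ (H s) _ _ (begin
  ∑ (allFin k) (λ c → H (toℕ c ℕ.+ suc s)) ℤ.+ H s
    ≡⟨ cong (ℤ._+ H s) (∑-cong (allFin k) (λ c → cong H (ℕP.+-suc (toℕ c) s))) ⟩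
  ∑ (allFin k) (λ c → G (suc (toℕ c))) ℤ.+ G 0   ≡⟨ ∑-shift k G ⟩
  ∑ (allFin k) (λ c → G (toℕ c)) ℤ.+ G k         ≡⟨ cong₂ ℤ._+_ (periodic-balanced k H period zero-sum s) (period s) ⟩
  0ℤ ℤ.+ H s                                       ∎)
  where
  G : ℕ → ℤ
  G t = H (t ℕ.+ s)
  open ≡-Reasoning

balanced-translate : ∀ k φ → Balanced k φ → (a : ℕ) → Balanced k (λ t → φ (a ℕ.+ t))
balanced-translate k φ balanced a s =
  trans (∑-cong (allFin k) (λ c → cong φ (swap-front a (toℕ c) s))) (balanced (a ℕ.+ s))
  where
  swap-front : ∀ a b c → a ℕ.+ (b ℕ.+ c) ≡ b ℕ.+ (a ℕ.+ c)
  swap-front a b c = trans (sym (ℕP.+-assoc a b c))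
    (trans (cong (ℕ._+ c) (ℕP.+-comm a b)) (ℕP.+-assoc b a c))

-- The centred edge indicator for k = K + 1: it is 1 on colour sums not divisible by k
-- (the k-set is an edge) and -K on multiples of k, i.e. k·[edge] - K.
centred : ℕ → ℕ → ℤ
centred K s = if does (¬? (s % suc K ℕ.≟ 0)) then 1ℤ else - (+ K)

-- Exactly one residue in k consecutive integers is 0, so the centred indicator is balanced.
centred-balanced : ∀ K → Balanced (suc K) (centred K)
centred-balanced K = periodic-balanced (suc K) (centred K) period zero-sum
  where
  value-at : ℕ → ℤ
  value-at r = if does (¬? (r ℕ.≟ 0)) then 1ℤ else - (+ K)

  period : ∀ s → centred K (suc K ℕ.+ s) ≡ centred K s
  period s = cong value-at
    (trans (cong (_% suc K) (ℕP.+-comm (suc K) s)) ([m+n]%n≡m%n s (suc K)))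

  nonzero-residue : (c : Fin K) → centred K (suc (toℕ c)) ≡ 1ℤ
  nonzero-residue c = cong value-at (m<n⇒m%n≡m (s≤s (FinP.toℕ<n c)))

  zero-sum : ∑ (allFin (suc K)) (λ c → centred K (toℕ c)) ≡ 0ℤ
  zero-sum = begin
    ∑ (allFin (suc K)) (λ c → centred K (toℕ c))
      ≡⟨ ∑-allFin-suc K (λ c → centred K (toℕ c)) ⟩
    - (+ K) ℤ.+ ∑ (allFin K) (λ c → centred K (suc (toℕ c)))
      ≡⟨ cong (ℤ._+_ (- (+ K))) (∑-cong (allFin K) nonzero-residue) ⟩
    - (+ K) ℤ.+ ∑ (allFin K) (λ _ → 1ℤ)
      ≡⟨ cong (ℤ._+_ (- (+ K))) (trans (∑-const (allFin K) 1ℤ) (ℤP.*-identityʳ _)) ⟩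
    - (+ K) ℤ.+ + length (allFin K)
      ≡⟨ cong (λ m → - (+ K) ℤ.+ + m) (ListP.length-tabulate id) ⟩
    - (+ K) ℤ.+ + K
      ≡⟨ ℤP.+-inverseˡ (+ K) ⟩
    0ℤ ∎
    where open ≡-Reasoning

∑-allVecs-suc : (k m : ℕ) (F : Vec (Fin k) (suc m) → ℤ) →
  ∑ (allVecs k (suc m)) F ≡ ∑ (allFin k) (λ c → ∑ (allVecs k m) (λ f → F (c ∷ f)))
∑-allVecs-suc k m F = trans (∑-concatMap _ (allFin k) F)
  (∑-cong (allFin k) (λ c → ∑-map (c ∷_) (allVecs k m) F))

-- The total colour of the slots selected by w.  Defs.colorSum is the instance where
-- slot i is selected when the i-th (k-1)-set lies inside the given k-set.
selectedSum : {k m : ℕ} → (Fin m → Bool) → Vec (Fin k) m → ℕ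
selectedSum {m = m} w f = sum (map (λ i → if w i then toℕ (Vec.lookup f i) else 0) (allFin m))

headColour : {k m : ℕ} → (Fin (suc m) → Bool) → Fin k → ℕ
headColour w c = if w zero then toℕ c else 0

selectedSum-∷ : {k m : ℕ} (w : Fin (suc m) → Bool) (c : Fin k) (f : Vec (Fin k) m) →
  selectedSum w (c ∷ f) ≡ headColour w c ℕ.+ selectedSum (w ∘ suc) f
selectedSum-∷ {m = m} w c f = cong (λ xs → headColour w c ℕ.+ sum xs)
  (trans (ListP.map-tabulate suc term) (sym (ListP.map-tabulate id (term ∘ suc))))
  where
  term : Fin (suc m) → ℕ
  term i = if w i then toℕ (Vec.lookup (c ∷ f) i) else 0

∑-peel : (k m : ℕ) (w w' : Fin (suc m) → Bool) (φ ψ : ℕ → ℤ) →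
  ∑ (allVecs k (suc m)) (λ f → φ (selectedSum w f) ℤ.* ψ (selectedSum w' f)) ≡
  ∑ (allFin k) (λ c → ∑ (allVecs k m) (λ f →
    φ (headColour w c ℕ.+ selectedSum (w ∘ suc) f) ℤ.* ψ (headColour w' c ℕ.+ selectedSum (w' ∘ suc) f)))
∑-peel k m w w' φ ψ = trans (∑-allVecs-suc k m _) (∑-cong (allFin k) (λ c → ∑-cong (allVecs k m) (λ f →
  cong₂ (λ a b → φ a ℤ.* ψ b) (selectedSum-∷ w c f) (selectedSum-∷ w' c f))))

-- If slot 0 is selected by w but not by w', sum over its colour first: the balanced φ
-- sees a full window of k consecutive arguments while ψ is unaffected, so everything cancels.
orthogonal-at-head : (k m : ℕ) (w w' : Fin (suc m) → Bool) (φ ψ : ℕ → ℤ) →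
  w zero ≡ true → w' zero ≡ false → Balanced k φ →
  ∑ (allVecs k (suc m)) (λ f → φ (selectedSum w f) ℤ.* ψ (selectedSum w' f)) ≡ 0ℤ
orthogonal-at-head k m w w' φ ψ w₀ w'₀ balanced = begin
  ∑ (allVecs k (suc m)) (λ f → φ (selectedSum w f) ℤ.* ψ (selectedSum w' f))
    ≡⟨ ∑-peel k m w w' φ ψ ⟩
  ∑ (allFin k) (λ c → ∑ (allVecs k m) (λ f → φ (headColour w c ℕ.+ W f) ℤ.* ψ (headColour w' c ℕ.+ W' f)))
    ≡⟨ ∑-cong (allFin k) (λ c → ∑-cong (allVecs k m) (λ f → cong₂ (λ a b → φ a ℤ.* ψ b)
         (cong (λ b → (if b then toℕ c else 0) ℕ.+ W f) w₀)
         (cong (λ b → (if b then toℕ c else 0) ℕ.+ W' f) w'₀))) ⟩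
  ∑ (allFin k) (λ c → ∑ (allVecs k m) (λ f → φ (toℕ c ℕ.+ W f) ℤ.* ψ (W' f)))
    ≡⟨ ∑-swap (allFin k) (allVecs k m) _ ⟩
  ∑ (allVecs k m) (λ f → ∑ (allFin k) (λ c → φ (toℕ c ℕ.+ W f) ℤ.* ψ (W' f)))
    ≡⟨ ∑-cong (allVecs k m) (λ f → ∑-*ʳ (allFin k) (ψ (W' f)) (λ c → φ (toℕ c ℕ.+ W f))) ⟩
  ∑ (allVecs k m) (λ f → ∑ (allFin k) (λ c → φ (toℕ c ℕ.+ W f)) ℤ.* ψ (W' f))
    ≡⟨ ∑-zero (All.universal (λ f → trans (cong (ℤ._* ψ (W' f)) (balanced (W f))) (ℤP.*-zeroˡ (ψ (W' f))))
         (allVecs k m)) ⟩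
  0ℤ ∎
  where
  W W' : Vec (Fin k) m → ℕ
  W  = selectedSum (w ∘ suc)
  W' = selectedSum (w' ∘ suc)
  open ≡-Reasoning

-- Slots before i are peeled off one at a time, their colour absorbed into translates of φ, ψ.
balanced-orthogonal : (k m : ℕ) (w w' : Fin m → Bool) (i : Fin m) → w i ≡ true → w' i ≡ false →
  (φ ψ : ℕ → ℤ) → Balanced k φ →
  ∑ (allVecs k m) (λ f → φ (selectedSum w f) ℤ.* ψ (selectedSum w' f)) ≡ 0ℤ
balanced-orthogonal k (suc m) w w' zero    w₀ w'₀ φ ψ balanced = orthogonal-at-head k m w w' φ ψ w₀ w'₀ balanced
balanced-orthogonal k (suc m) w w' (suc j) wⱼ w'ⱼ φ ψ balanced = trans (∑-peel k m w w' φ ψ)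
  (∑-zero (All.universal (λ c →
    balanced-orthogonal k m (w ∘ suc) (w' ∘ suc) j wⱼ w'ⱼ
      (λ t → φ (headColour w c ℕ.+ t)) (λ t → ψ (headColour w' c ℕ.+ t))
      (balanced-translate k φ balanced (headColour w c))) (allFin k)))

⊈-witness : ∀ {n} (E E' : Subset n) → ¬ (E ⊆ E') → ∃ λ x → x ∈ E × x ∉ E'
⊈-witness []            []             E⊈E' = ⊥-elim (E⊈E' id)
⊈-witness (inside ∷ E)  (outside ∷ E') E⊈E' = zero , here , λ ()
⊈-witness (inside ∷ E)  (inside ∷ E')  E⊈E' with ⊈-witness E E' (E⊈E' ∘ in⊆in)
... | x , x∈E , x∉E' = suc x , there x∈E , x∉E' ∘ drop-there
⊈-witness (outside ∷ E) (_ ∷ E')       E⊈E' with ⊈-witness E E' (E⊈E' ∘ out⊆)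
... | x , x∈E , x∉E' = suc x , there x∈E , x∉E' ∘ drop-there

subset-of-size : ∀ {n} (E : Subset n) r → r ≤ ∣ E ∣ → ∃ λ T → T ⊆ E × ∣ T ∣ ≡ r
subset-of-size []            zero    _         = [] , id , refl
subset-of-size (outside ∷ E) r       r≤∣E∣     with subset-of-size E r r≤∣E∣
... | T , T⊆E , ∣T∣≡r = outside ∷ T , s⊆s T⊆E , ∣T∣≡r
subset-of-size (inside ∷ E)  zero    _         with subset-of-size E zero z≤n
... | T , T⊆E , ∣T∣≡0 = outside ∷ T , out⊆ T⊆E , ∣T∣≡0
subset-of-size (inside ∷ E)  (suc r) (s≤s r≤∣E∣) with subset-of-size E r r≤∣E∣
... | T , T⊆E , ∣T∣≡r = inside ∷ T , s⊆s T⊆E , cong suc ∣T∣≡r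

subset-through : ∀ {n} (E : Subset n) (x : Fin n) m → x ∈ E → 1 ≤ m → m ≤ ∣ E ∣ →
  ∃ λ T → T ⊆ E × x ∈ T × ∣ T ∣ ≡ m
subset-through (inside ∷ E) zero (suc m) here _ (s≤s m≤∣E∣) with subset-of-size E m m≤∣E∣
... | T , T⊆E , ∣T∣≡m = inside ∷ T , s⊆s T⊆E , here , cong suc ∣T∣≡m
subset-through (b ∷ E) (suc x) m (there x∈E) 1≤m m≤∣bE∣ with m ℕP.≤? ∣ E ∣
... | yes m≤∣E∣ with subset-through E x m x∈E 1≤m m≤∣E∣
...   | T , T⊆E , x∈T , ∣T∣≡m = outside ∷ T , out⊆ T⊆E , there x∈T , ∣T∣≡m
subset-through (outside ∷ E) (suc x) m (there x∈E) 1≤m m≤∣E∣ | no m≰∣E∣ = contradiction m≤∣E∣ m≰∣E∣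
-- Too large to avoid the head point: the whole set has exactly the required size.
subset-through (inside ∷ E)  (suc x) m (there x∈E) 1≤m m≤∣E∣ | no m≰∣E∣ =
  inside ∷ E , id , there x∈E , ℕP.≤-antisym (ℕP.≰⇒> m≰∣E∣) m≤∣E∣

separating-subset : ∀ {n} (E E' : Subset n) m → ¬ (E ⊆ E') → 1 ≤ m → m ≤ ∣ E ∣ →
  ∃ λ T → ∣ T ∣ ≡ m × T ⊆ E × ¬ (T ⊆ E')
separating-subset E E' m E⊈E' 1≤m m≤∣E∣ with ⊈-witness E E' E⊈E'
... | x , x∈E , x∉E' with subset-through E x m x∈E 1≤m m≤∣E∣
...   | T , T⊆E , x∈T , ∣T∣≡m = T , ∣T∣≡m , T⊆E , λ T⊆E' → x∉E' (T⊆E' x∈T)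

allSubsets-complete : ∀ {n} (T : Subset n) → T ∈ₗ allSubsets n
allSubsets-complete []                = here refl
allSubsets-complete {suc n} (inside ∷ T)  =
  ∈-++⁺ˡ (∈-map⁺ (inside ∷_) (allSubsets-complete T))
allSubsets-complete {suc n} (outside ∷ T) =
  ∈-++⁺ʳ (map (inside ∷_) (allSubsets n)) (∈-map⁺ (outside ∷_) (allSubsets-complete T))

-- No subset is listed twice: the two halves of allSubsets (suc n) differ in the head.
allSubsets-unique : ∀ n → Unique (allSubsets n)
allSubsets-unique zero    = [] ∷ []
allSubsets-unique (suc n) =
  UniqueP.++⁺ (UniqueP.map⁺ ∷-injectiveʳ (allSubsets-unique n))
              (UniqueP.map⁺ ∷-injectiveʳ (allSubsets-unique n)) different-heads
  where
  ∷-injectiveʳ : ∀ {b} {T T' : Subset n} → _≡_ {A = Subset (suc n)} (b ∷ T) (b ∷ T') → T ≡ T'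
  ∷-injectiveʳ refl = refl
  different-heads : ∀ {T} → ¬ (T ∈ₗ map (inside ∷_) (allSubsets n) × T ∈ₗ map (outside ∷_) (allSubsets n))
  different-heads (T∈ins , T∈outs) with ∈-map⁻ (inside ∷_) T∈ins | ∈-map⁻ (outside ∷_) T∈outs
  ... | _ , _ , refl | _ , _ , ()

∈-kSubsets : ∀ {n j} (T : Subset n) → ∣ T ∣ ≡ j → T ∈ₗ kSubsets n j
∈-kSubsets {n} {j} T ∣T∣≡j = ∈-filter⁺ (λ s → ∣ s ∣ ℕ.≟ j) (allSubsets-complete T) ∣T∣≡j

kSubsets-size : ∀ {n j} {T : Subset n} → T ∈ₗ kSubsets n j → ∣ T ∣ ≡ j
kSubsets-size {n} {j} T∈ = proj₂ (∈-filter⁻ (λ s → ∣ s ∣ ℕ.≟ j) {xs = allSubsets n} T∈)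

length-filter-map : {A B : Set} {P : B → Set} (P? : Decidable P) (g : A → B) (xs : List A) →
  length (filter P? (map g xs)) ≡ length (filter (P? ∘ g) xs)
length-filter-map P? g []       = refl
length-filter-map P? g (x ∷ xs) with does (P? (g x))
... | true  = cong suc (length-filter-map P? g xs)
... | false = length-filter-map P? g xs

-- Pascal's rule on the enumeration: there are n C j subsets of size j.
length-kSubsets : ∀ n j → length (kSubsets n j) ≡ n C j
length-kSubsets zero    zero    = refl
length-kSubsets zero    (suc j) = refl
length-kSubsets (suc n) j = begin
  length (filter has-j (map (inside ∷_) S ++ map (outside ∷_) S))
    ≡⟨ cong length (ListP.filter-++ has-j (map (inside ∷_) S) (map (outside ∷_) S)) ⟩
  length (filter has-j (map (inside ∷_) S) ++ filter has-j (map (outside ∷_) S))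
    ≡⟨ ListP.length-++ (filter has-j (map (inside ∷_) S)) ⟩
  length (filter has-j (map (inside ∷_) S)) ℕ.+ length (filter has-j (map (outside ∷_) S))
    ≡⟨ cong₂ ℕ._+_ (length-filter-map has-j (inside ∷_) S) (length-filter-map has-j (outside ∷_) S) ⟩
  length (filter (has-j ∘ (inside ∷_)) S) ℕ.+ length (kSubsets n j)
    ≡⟨ cong₂ ℕ._+_ (with-head j) (length-kSubsets n j) ⟩
  predecessor-count j ℕ.+ n C j
    ≡⟨ pascal j ⟩
  suc n C j ∎
  where
  S : List (Subset n)
  S = allSubsets n
  has-j : (T : Subset (suc n)) → Dec (∣ T ∣ ≡ j)
  has-j T = ∣ T ∣ ℕ.≟ j
  -- the number of (j-1)-subsets of Fin n, i.e. of j-subsets of Fin (suc n) containing 0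
  predecessor-count : ℕ → ℕ
  predecessor-count zero    = 0
  predecessor-count (suc j) = n C j
  with-head : ∀ j → length (filter (λ T → ∣ inside ∷ T ∣ ℕ.≟ j) S) ≡ predecessor-count j
  with-head zero    = cong length (ListP.filter-none (λ T → ∣ inside ∷ T ∣ ℕ.≟ zero) (All.universal (λ _ ()) S))
  with-head (suc j) = trans
    (cong length (ListP.filter-≐ (λ T → ∣ inside ∷ T ∣ ℕ.≟ suc j) (λ T → ∣ T ∣ ℕ.≟ j) (ℕP.suc-injective , cong suc) S))
    (length-kSubsets n j)
  pascal : ∀ j → predecessor-count j ℕ.+ n C j ≡ suc n C j
  pascal zero    = refl
  pascal (suc j) = nCk+nC[k+1]≡[n+1]C[k+1] n j
  open ≡-Reasoning

C≤^ : ∀ n j → n C j ≤ n ^ j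
C≤^ n       zero    = ℕP.≤-refl
C≤^ zero    (suc j) = z≤n
C≤^ (suc n) (suc j) = subst (_≤ suc n ^ suc j) (nCk+nC[k+1]≡[n+1]C[k+1] n j)
  (ℕP.+-mono-≤ (ℕP.≤-trans (C≤^ n j) n^j≤[1+n]^j)
               (ℕP.≤-trans (C≤^ n (suc j)) (ℕP.*-monoʳ-≤ n n^j≤[1+n]^j)))
  where
  n^j≤[1+n]^j : n ^ j ≤ suc n ^ j
  n^j≤[1+n]^j = ℕP.^-monoˡ-≤ j (ℕP.n≤1+n n)

pythagoras : {I Ω : Set} (samples : List Ω) (Z : I → Ω → ℤ) (c : ℤ) (Es : List I) → Unique Es →
  (∀ {E E'} → E ∈ₗ Es → E' ∈ₗ Es → E ≢ E' → ∑ samples (λ f → Z E f ℤ.* Z E' f) ≡ 0ℤ) →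
  (∀ E → ∑ samples (λ f → Z E f ℤ.* Z E f) ℤ.≤ c) →
  ∑ samples (λ f → ∑ Es (λ E → Z E f) ℤ.* ∑ Es (λ E → Z E f)) ℤ.≤ + length Es ℤ.* c
pythagoras samples Z c [] _ _ _ = begin
  ∑ samples (λ _ → 0ℤ)  ≡⟨ ∑-zero (All.universal (λ _ → refl) samples) ⟩
  0ℤ                   ≡⟨ sym (ℤP.*-zeroˡ c) ⟩
  0ℤ ℤ.* c             ∎
  where open ℤP.≤-Reasoning
pythagoras {Ω = Ω} samples Z c (E ∷ Es) (E∉Es ∷ unique) orthogonal bound = begin
  ∑ samples (λ f → (a f ℤ.+ b f) ℤ.* (a f ℤ.+ b f))
    ≡⟨ ∑-cong samples (λ f → square-expand (a f) (b f)) ⟩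
  ∑ samples (λ f → a f ℤ.* a f ℤ.+ ((a f ℤ.* b f ℤ.+ a f ℤ.* b f) ℤ.+ b f ℤ.* b f))
    ≡⟨ ∑-+ samples _ _ ⟩
  ∑ samples (λ f → a f ℤ.* a f) ℤ.+ ∑ samples (λ f → (a f ℤ.* b f ℤ.+ a f ℤ.* b f) ℤ.+ b f ℤ.* b f)
    ≡⟨ cong (ℤ._+_ (∑ samples (λ f → a f ℤ.* a f))) (trans (∑-+ samples _ _)
         (cong (ℤ._+ ∑ samples (λ f → b f ℤ.* b f)) (trans (∑-+ samples _ _) (cong₂ ℤ._+_ cross cross)))) ⟩
  ∑ samples (λ f → a f ℤ.* a f) ℤ.+ (0ℤ ℤ.+ ∑ samples (λ f → b f ℤ.* b f))
    ≡⟨ cong (ℤ._+_ (∑ samples (λ f → a f ℤ.* a f))) (ℤP.+-identityˡ _) ⟩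
  ∑ samples (λ f → a f ℤ.* a f) ℤ.+ ∑ samples (λ f → b f ℤ.* b f)
    ≤⟨ ℤP.+-mono-≤ (bound E)
         (pythagoras samples Z c Es unique (λ E∈ E'∈ → orthogonal (there E∈) (there E'∈)) bound) ⟩
  c ℤ.+ + length Es ℤ.* c
    ≡⟨ cong (ℤ._+ (+ length Es ℤ.* c)) (sym (ℤP.*-identityˡ c)) ⟩
  1ℤ ℤ.* c ℤ.+ + length Es ℤ.* c
    ≡⟨ sym (ℤP.*-distribʳ-+ c 1ℤ (+ length Es)) ⟩
  + length (E ∷ Es) ℤ.* c ∎
  where
  a b : Ω → ℤ
  a f = Z E f
  b f = ∑ Es (λ E' → Z E' f)
  square-expand : ∀ x y → (x ℤ.+ y) ℤ.* (x ℤ.+ y) ≡ x ℤ.* x ℤ.+ ((x ℤ.* y ℤ.+ x ℤ.* y) ℤ.+ y ℤ.* y)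
  square-expand = solve-∀
  cross : ∑ samples (λ f → a f ℤ.* b f) ≡ 0ℤ
  cross = trans (∑-cong samples (λ f → sym (∑-*ˡ Es (a f) (λ E' → Z E' f))))
    (trans (∑-swap samples Es (λ f E' → a f ℤ.* Z E' f))
      (∑-zero (All.tabulate (λ E'∈Es → orthogonal (here refl) (there E'∈Es) (All.lookup E∉Es E'∈Es)))))
  open ℤP.≤-Reasoning

count-as-sum : {A : Set} {P : A → Set} (K : ℕ) (P? : Decidable P) (xs : List A) →
  + suc K ℤ.* + length (filter P? xs) ℤ.- + K ℤ.* + length xs
    ≡ ∑ xs (λ x → if does (P? x) then 1ℤ else - (+ K))
count-as-sum K P? [] = empty (+ suc K) (+ K)
  where
  empty : ∀ a b → a ℤ.* 0ℤ ℤ.- b ℤ.* 0ℤ ≡ 0ℤ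
  empty = solve-∀
count-as-sum K P? (x ∷ xs) with does (P? x)
... | true  = trans (accept (+ K) (+ length (filter P? xs)) (+ length xs)) (cong (ℤ._+_ 1ℤ) (count-as-sum K P? xs))
  where
  accept : ∀ K L N → (1ℤ ℤ.+ K) ℤ.* (1ℤ ℤ.+ L) ℤ.- K ℤ.* (1ℤ ℤ.+ N) ≡ 1ℤ ℤ.+ ((1ℤ ℤ.+ K) ℤ.* L ℤ.- K ℤ.* N)
  accept = solve-∀
... | false = trans (reject (+ K) (+ length (filter P? xs)) (+ length xs)) (cong (ℤ._+_ (- (+ K))) (count-as-sum K P? xs))
  where
  reject : ∀ K L N → (1ℤ ℤ.+ K) ℤ.* L ℤ.- K ℤ.* (1ℤ ℤ.+ N) ≡ - K ℤ.+ ((1ℤ ℤ.+ K) ℤ.* L ℤ.- K ℤ.* N)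
  reject = solve-∀

length-filter-split : {A : Set} {P : A → Set} (P? : Decidable P) (xs : List A) →
  length (filter P? xs) ℕ.+ length (filter (¬? ∘ P?) xs) ≡ length xs
length-filter-split P? []       = refl
length-filter-split P? (x ∷ xs) with P? x
... | yes _ = cong suc (length-filter-split P? xs)
... | no  _ = trans (ℕP.+-suc _ _) (cong suc (length-filter-split P? xs))

markov : {A : Set} {P : A → Set} (P? : Decidable P) (g : A → ℤ) (t : ℤ) →
  (∀ x → 0ℤ ℤ.≤ g x) → (∀ x → ¬ P x → t ℤ.≤ g x) → (xs : List A) →
  + length (filter (¬? ∘ P?) xs) ℤ.* t ℤ.≤ ∑ xs g
markov P? g t g≥0 t≤g []       = ℤP.≤-reflexive (ℤP.*-zeroˡ t)
markov P? g t g≥0 t≤g (x ∷ xs) with P? x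
... | yes _  = ℤP.≤-trans (markov P? g t g≥0 t≤g xs)
  (subst (ℤ._≤ g x ℤ.+ ∑ xs g) (ℤP.+-identityˡ (∑ xs g)) (ℤP.+-monoˡ-≤ (∑ xs g) (g≥0 x)))
... | no ¬Px = begin
  + suc (length (filter (¬? ∘ P?) xs)) ℤ.* t
    ≡⟨ ℤP.*-distribʳ-+ t 1ℤ (+ length (filter (¬? ∘ P?) xs)) ⟩
  1ℤ ℤ.* t ℤ.+ + length (filter (¬? ∘ P?) xs) ℤ.* t
    ≡⟨ cong (ℤ._+ (+ length (filter (¬? ∘ P?) xs) ℤ.* t)) (ℤP.*-identityˡ t) ⟩
  t ℤ.+ + length (filter (¬? ∘ P?) xs) ℤ.* t
    ≤⟨ ℤP.+-mono-≤ (t≤g x ¬Px) (markov P? g t g≥0 t≤g xs) ⟩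
  g x ℤ.+ ∑ xs g ∎
  where open ℤP.≤-Reasoning

square-abs : ∀ (y : ℤ) b → + ((ℤ.∣ y ∣ ℕ.* b) ℕ.* (ℤ.∣ y ∣ ℕ.* b)) ≡ (y ℤ.* y) ℤ.* + (b ℕ.* b)
square-abs y b = begin
  + ((ℤ.∣ y ∣ ℕ.* b) ℕ.* (ℤ.∣ y ∣ ℕ.* b)) ≡⟨ cong +_ (regroup ℤ.∣ y ∣ b) ⟩
  + ((ℤ.∣ y ∣ ℕ.* ℤ.∣ y ∣) ℕ.* (b ℕ.* b)) ≡⟨ ℤP.pos-* (ℤ.∣ y ∣ ℕ.* ℤ.∣ y ∣) (b ℕ.* b) ⟩
  + (ℤ.∣ y ∣ ℕ.* ℤ.∣ y ∣) ℤ.* + (b ℕ.* b) ≡⟨ cong (ℤ._* + (b ℕ.* b)) (pos-abs² y) ⟩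
  (y ℤ.* y) ℤ.* + (b ℕ.* b)              ∎
  where
  regroup : ∀ m b → (m ℕ.* b) ℕ.* (m ℕ.* b) ≡ (m ℕ.* m) ℕ.* (b ℕ.* b)
  regroup = solve-∀ℕ
  pos-abs² : ∀ y → + (ℤ.∣ y ∣ ℕ.* ℤ.∣ y ∣) ≡ y ℤ.* y
  pos-abs² (+ m)      = ℤP.pos-* m m
  pos-abs² ℤ.-[1+ m ] = refl
  open ≡-Reasoning

centred-square : ∀ {K} → 1 ≤ K → ∀ s → centred K s ℤ.* centred K s ℤ.≤ + (K ℕ.* K)
centred-square {suc K} (s≤s z≤n) s with does (¬? (s % suc (suc K) ℕ.≟ 0))
... | true  = +≤+ (s≤s z≤n)
... | false = ℤP.≤-refl

module Hypergraph (K n : ℕ) where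

  k : ℕ
  k = suc K

  Colourings : List (Coloring k n)
  Colourings = allColorings k n

  #colourings : ℕ
  #colourings = length Colourings

  -- The colour slots are the (k−1)-sets; slot i counts towards E when it lies inside E.
  slotsIn : Subset n → Fin (length (Tsets k n)) → Bool
  slotsIn E i = ⌊ lookup (Tsets k n) i ⊆? E ⌋

  Z : Subset n → Coloring k n → ℤ
  Z E f = centred K (selectedSum (slotsIn E) f)

  Y : Coloring k n → ℤ
  Y f = ∑ (kSubsets n k) (λ E → Z E f)

  -- Y f = k · |A| − (k−1) · C(n, k), i.e. k times the deviation of |A| from p C(n, k).
  -- (The proof of k ≢ 0 that numEdges carries is irrelevant; it is left arbitrary.)
  Y-counts-edges : (k≢0 : NonZero k) → ∀ f → + k ℤ.* + numEdges k n {{k≢0}} f ℤ.- + K ℤ.* + (n C k) ≡ Y f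
  Y-counts-edges k≢0 f =
    subst (λ N → + k ℤ.* + numEdges k n {{k≢0}} f ℤ.- + K ℤ.* + N ≡ Y f) (length-kSubsets n k)
      (count-as-sum K (λ E → ¬? (colorSum k n f E % k ℕ.≟ 0)) (kSubsets n k))

  slot-of : (T : Subset n) → ∣ T ∣ ≡ K →
    ∃ λ i → ∀ E → (T ⊆ E → slotsIn E i ≡ true) × (¬ T ⊆ E → slotsIn E i ≡ false)
  slot-of T ∣T∣≡K = Any.index T∈ , λ E →
      (λ T⊆E → trans (isYes≗does (slot ⊆? E)) (dec-true (slot ⊆? E) (subst (_⊆ E) T≡slot T⊆E)))
    , (λ T⊈E → trans (isYes≗does (slot ⊆? E)) (dec-false (slot ⊆? E) (T⊈E ∘ subst (_⊆ E) (sym T≡slot))))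
    where
    T∈ : T ∈ₗ Tsets k n
    T∈ = ∈-kSubsets T ∣T∣≡K
    slot : Subset n
    slot = lookup (Tsets k n) (Any.index T∈)
    T≡slot : T ≡ slot
    T≡slot = lookup-index T∈

  -- If the k-set E is not inside E', some K-subset of E is a slot of E but not of E';
  -- its colour is uniform and independent of the rest, so Z E and Z E' are orthogonal.
  orthogonal-⊈ : 1 ≤ K → ∀ {E E'} → ∣ E ∣ ≡ k → ¬ E ⊆ E' → ∑ Colourings (λ f → Z E f ℤ.* Z E' f) ≡ 0ℤ
  orthogonal-⊈ 1≤K {E} {E'} ∣E∣≡k E⊈E'
    with separating-subset E E' K E⊈E' 1≤K (subst (K ≤_) (sym ∣E∣≡k) (ℕP.n≤1+n K))
  ... | T , ∣T∣≡K , T⊆E , T⊈E' with slot-of T ∣T∣≡K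
  ...   | i , selects = balanced-orthogonal k _ (slotsIn E) (slotsIn E') i
            (proj₁ (selects E) T⊆E) (proj₂ (selects E') T⊈E') (centred K) (centred K) (centred-balanced K)

  orthogonal-edges : 1 ≤ K → ∀ {E E'} → ∣ E ∣ ≡ k → ∣ E' ∣ ≡ k → E ≢ E' →
    ∑ Colourings (λ f → Z E f ℤ.* Z E' f) ≡ 0ℤ
  orthogonal-edges 1≤K {E} {E'} ∣E∣≡k ∣E'∣≡k E≢E' with E ⊆? E'
  ... | no  E⊈E' = orthogonal-⊈ 1≤K ∣E∣≡k E⊈E'
  ... | yes E⊆E' = trans (∑-cong Colourings (λ f → ℤP.*-comm (Z E f) (Z E' f)))
                         (orthogonal-⊈ 1≤K ∣E'∣≡k (E≢E' ∘ ⊆-antisym E⊆E'))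

  second-moment : 1 ≤ K →
    ∑ Colourings (λ f → Y f ℤ.* Y f) ℤ.≤ + (n C k) ℤ.* (+ #colourings ℤ.* + (K ℕ.* K))
  second-moment 1≤K = subst (λ N → ∑ Colourings (λ f → Y f ℤ.* Y f) ℤ.≤ + N ℤ.* c) (length-kSubsets n k)
    (pythagoras Colourings Z c (kSubsets n k) (UniqueP.filter⁺ _ (allSubsets-unique n))
      (λ E∈ E'∈ → orthogonal-edges 1≤K (kSubsets-size E∈) (kSubsets-size E'∈))
      (λ E → ℤP.≤-trans (∑-mono Colourings (λ f → centred-square 1≤K (selectedSum (slotsIn E) f)))
                        (ℤP.≤-reflexive (∑-const Colourings _))))
    where
    c : ℤ
    c = + #colourings ℤ.* + (K ℕ.* K)

  chebyshev : 1 ≤ K → {P : Coloring k n → Set} (P? : Decidable P) (α b : ℕ) →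
    (∀ f → ¬ P f → α ≤ ℤ.∣ Y f ∣ ℕ.* b) →
    length (filter (¬? ∘ P?) Colourings) ℕ.* (α ℕ.* α) ≤ ((n C k) ℕ.* (#colourings ℕ.* (K ℕ.* K))) ℕ.* (b ℕ.* b)
  chebyshev 1≤K P? α b far = ℤP.drop‿+≤+ (begin
    + (bad ℕ.* (α ℕ.* α))                  ≡⟨ ℤP.pos-* bad (α ℕ.* α) ⟩
    + bad ℤ.* + (α ℕ.* α)                  ≤⟨ markov P? scaled-square (+ (α ℕ.* α)) (λ _ → +≤+ z≤n)
                                                (λ f ¬Pf → +≤+ (ℕP.*-mono-≤ (far f ¬Pf) (far f ¬Pf))) Colourings ⟩
    ∑ Colourings scaled-square             ≡⟨ ∑-cong Colourings (λ f → square-abs (Y f) b) ⟩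
    ∑ Colourings (λ f → (Y f ℤ.* Y f) ℤ.* + (b ℕ.* b))
      ≡⟨ ∑-*ʳ Colourings (+ (b ℕ.* b)) (λ f → Y f ℤ.* Y f) ⟩
    ∑ Colourings (λ f → Y f ℤ.* Y f) ℤ.* + (b ℕ.* b)
      ≤⟨ ℤP.*-monoʳ-≤-nonNeg (+ (b ℕ.* b)) (second-moment 1≤K) ⟩
    (+ (n C k) ℤ.* (+ #colourings ℤ.* + (K ℕ.* K))) ℤ.* + (b ℕ.* b)
      ≡⟨ sym (trans (ℤP.pos-* ((n C k) ℕ.* (#colourings ℕ.* (K ℕ.* K))) (b ℕ.* b)) (cong (ℤ._* + (b ℕ.* b))
           (trans (ℤP.pos-* (n C k) (#colourings ℕ.* (K ℕ.* K))) (cong (ℤ._*_ (+ (n C k))) (ℤP.pos-* #colourings (K ℕ.* K)))))) ⟩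
    + (((n C k) ℕ.* (#colourings ℕ.* (K ℕ.* K))) ℕ.* (b ℕ.* b)) ∎)
    where
    bad : ℕ
    bad = length (filter (¬? ∘ P?) Colourings)
    scaled-square : Coloring k n → ℤ
    scaled-square f = + ((ℤ.∣ Y f ∣ ℕ.* b) ℕ.* (ℤ.∣ Y f ∣ ℕ.* b))
    open ℤP.≤-Reasoning

-- Integers as rationals; Defs.ℕ→ℚ m is ℤ→ℚ (+ m) by definition.
ℤ→ℚ : ℤ → ℚ
ℤ→ℚ i = i ℚ./ 1

ℤ→ℚ-≃ : ∀ i → ℚ.toℚᵘ (ℤ→ℚ i) U.≃ mkℚᵘ i 0
ℤ→ℚ-≃ i = ℚP.toℚᵘ-fromℚᵘ (mkℚᵘ i 0)

ℤ→ℚ-+ : ∀ a b → ℤ→ℚ (a ℤ.+ b) ≡ ℤ→ℚ a ℚ.+ ℤ→ℚ b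
ℤ→ℚ-+ a b = ℚP.toℚᵘ-injective (UP.≃-trans (ℤ→ℚ-≃ (a ℤ.+ b)) (UP.≃-trans (*≡* (cross-multiply a b))
  (UP.≃-sym (UP.≃-trans (ℚP.toℚᵘ-homo-+ (ℤ→ℚ a) (ℤ→ℚ b)) (UP.+-cong (ℤ→ℚ-≃ a) (ℤ→ℚ-≃ b))))))
  where
  cross-multiply : ∀ (a b : ℤ) → (a ℤ.+ b) ℤ.* 1ℤ ≡ (a ℤ.* 1ℤ ℤ.+ b ℤ.* 1ℤ) ℤ.* 1ℤ
  cross-multiply = solve-∀

ℤ→ℚ-* : ∀ a b → ℤ→ℚ (a ℤ.* b) ≡ ℤ→ℚ a ℚ.* ℤ→ℚ b
ℤ→ℚ-* a b = ℚP.toℚᵘ-injective (UP.≃-trans (ℤ→ℚ-≃ (a ℤ.* b)) (UP.≃-trans (*≡* refl)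
  (UP.≃-sym (UP.≃-trans (ℚP.toℚᵘ-homo-* (ℤ→ℚ a) (ℤ→ℚ b)) (UP.*-cong (ℤ→ℚ-≃ a) (ℤ→ℚ-≃ b))))))

ℤ→ℚ-neg : ∀ a → ℤ→ℚ (- a) ≡ ℚ.- ℤ→ℚ a
ℤ→ℚ-neg a = ℚP.toℚᵘ-injective (UP.≃-trans (ℤ→ℚ-≃ (- a)) (UP.≃-trans (*≡* refl)
  (UP.≃-sym (UP.≃-trans (ℚP.toℚᵘ-homo‿- (ℤ→ℚ a)) (UP.-‿cong (ℤ→ℚ-≃ a))))))

ℤ→ℚ-∣∣ : ∀ a → ℚ.∣ ℤ→ℚ a ∣ ≡ ℤ→ℚ (+ ℤ.∣ a ∣)
ℤ→ℚ-∣∣ a = ℚP.toℚᵘ-injective (UP.≃-trans (ℚP.toℚᵘ-homo-∣-∣ (ℤ→ℚ a))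
  (UP.≃-trans (UP.∣-∣-cong (ℤ→ℚ-≃ a)) (UP.≃-trans (*≡* (abs-fraction a)) (UP.≃-sym (ℤ→ℚ-≃ (+ ℤ.∣ a ∣))))))
  where
  abs-fraction : ∀ a → U.↥ (U.∣ mkℚᵘ a 0 ∣) ℤ.* 1ℤ ≡ + ℤ.∣ a ∣ ℤ.* 1ℤ
  abs-fraction (+ n)      = refl
  abs-fraction ℤ.-[1+ n ] = refl

ℤ→ℚ-mono-≤ : ∀ {a b} → a ℤ.≤ b → ℤ→ℚ a ℚ.≤ ℤ→ℚ b
ℤ→ℚ-mono-≤ {a} {b} a≤b = ℚP.toℚᵘ-cancel-≤ (UP.≤-respʳ-≃ (UP.≃-sym (ℤ→ℚ-≃ b)) (UP.≤-respˡ-≃ (UP.≃-sym (ℤ→ℚ-≃ a))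
  (*≤* (subst₂ ℤ._≤_ (sym (ℤP.*-identityʳ a)) (sym (ℤP.*-identityʳ b)) a≤b))))

ℤ→ℚ-cancel-≤ : ∀ {a b} → ℤ→ℚ a ℚ.≤ ℤ→ℚ b → a ℤ.≤ b
ℤ→ℚ-cancel-≤ {a} {b} a≤b with UP.≤-respʳ-≃ (ℤ→ℚ-≃ b) (UP.≤-respˡ-≃ (ℤ→ℚ-≃ a) (ℚP.toℚᵘ-mono-≤ a≤b))
... | *≤* a*1≤b*1 = subst₂ ℤ._≤_ (ℤP.*-identityʳ a) (ℤP.*-identityʳ b) a*1≤b*1

ℕ→ℚ-* : ∀ m n → ℕ→ℚ (m ℕ.* n) ≡ ℕ→ℚ m ℚ.* ℕ→ℚ n
ℕ→ℚ-* m n = trans (cong ℤ→ℚ (ℤP.pos-* m n)) (ℤ→ℚ-* (+ m) (+ n))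

ℕ→ℚ-nonNeg : ∀ m → ℚ.NonNegative (ℕ→ℚ m)
ℕ→ℚ-nonNeg m = ℚP.normalize-nonNeg m 1

ℕ→ℚ-pos : ∀ m → ℚ.Positive (ℕ→ℚ (suc m))
ℕ→ℚ-pos m = ℚP.normalize-pos (suc m) 1

/-*-cancel : ∀ i d-1 → (i ℚ./ suc d-1) ℚ.* ℤ→ℚ (+ suc d-1) ≡ ℤ→ℚ i
/-*-cancel i d-1 = ℚP.toℚᵘ-injective (UP.≃-trans (ℚP.toℚᵘ-homo-* (i ℚ./ suc d-1) (ℤ→ℚ (+ suc d-1)))
  (UP.≃-trans (UP.*-cong (ℚP.toℚᵘ-fromℚᵘ (mkℚᵘ i d-1)) (ℤ→ℚ-≃ (+ suc d-1)))
  (UP.≃-trans (*≡* (fraction i d-1)) (UP.≃-sym (ℤ→ℚ-≃ i)))))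
  where
  fraction : ∀ i d-1 → (i ℤ.* + suc d-1) ℤ.* 1ℤ ≡ i ℤ.* U.↧ (mkℚᵘ i d-1 U.* mkℚᵘ (+ suc d-1) 0)
  fraction i d-1 = trans (ℤP.*-identityʳ _) (cong (λ m → i ℤ.* + suc m) (sym (ℕP.*-identityʳ d-1)))

positive-fraction : (p : ℚ) → Positive p → ∃ λ a → ∃ λ b-1 → p ≡ + suc a ℚ./ suc b-1
positive-fraction p@(mkℚ ℤ.+[1+ a ] b-1 _) _ = a , b-1 , sym (ℚP.↥p/↧p≡p p)

deviation-scaled : ∀ K X C →
  (ℕ→ℚ X ℚ.- (+ K ℚ./ suc K) ℚ.* ℕ→ℚ C) ℚ.* ℕ→ℚ (suc K) ≡ ℤ→ℚ (+ suc K ℤ.* + X ℤ.- + K ℤ.* + C)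
deviation-scaled K X C = begin
  (ℕ→ℚ X ℚ.- p ℚ.* ℕ→ℚ C) ℚ.* ℕ→ℚ k
    ≡⟨ solve 4 (λ x p c kk → (x :- p :* c) :* kk := kk :* x :- (p :* kk) :* c) refl (ℕ→ℚ X) p (ℕ→ℚ C) (ℕ→ℚ k) ⟩
  ℕ→ℚ k ℚ.* ℕ→ℚ X ℚ.- (p ℚ.* ℕ→ℚ k) ℚ.* ℕ→ℚ C
    ≡⟨ cong (λ z → ℕ→ℚ k ℚ.* ℕ→ℚ X ℚ.- z ℚ.* ℕ→ℚ C) (/-*-cancel (+ K) K) ⟩
  ℕ→ℚ k ℚ.* ℕ→ℚ X ℚ.- ℕ→ℚ K ℚ.* ℕ→ℚ C
    ≡⟨ sym (trans (ℤ→ℚ-+ (+ k ℤ.* + X) (- (+ K ℤ.* + C)))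
         (cong₂ ℚ._+_ (ℤ→ℚ-* (+ k) (+ X)) (trans (ℤ→ℚ-neg (+ K ℤ.* + C)) (cong ℚ.-_ (ℤ→ℚ-* (+ K) (+ C)))))) ⟩
  ℤ→ℚ (+ k ℤ.* + X ℤ.- + K ℤ.* + C) ∎
  where
  k : ℕ
  k = suc K
  p : ℚ
  p = + K ℚ./ suc K
  open +-*-Solver
  open ≡-Reasoning

far-from-mean : ∀ K a b-1 X C N (y : ℤ) → + suc K ℤ.* + X ℤ.- + K ℤ.* + C ≡ y →
  ¬ (ℚ.∣ ℕ→ℚ X ℚ.- (+ K ℚ./ suc K) ℚ.* ℕ→ℚ C ∣ ℚ.< (+ suc a ℚ./ suc b-1) ℚ.* ℕ→ℚ N) →
  N ℕ.* suc K ≤ ℤ.∣ y ∣ ℕ.* suc b-1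
far-from-mean K a b-1 X C N y y≡ not-close =
  ℕP.≤-trans (ℕP.*-monoˡ-≤ k (ℕP.m≤n*m N A)) (ℤP.drop‿+≤+ (ℤ→ℚ-cancel-≤ scaled))
  where
  k A b : ℕ
  k = suc K
  A = suc a
  b = suc b-1
  ε D : ℚ
  ε = + A ℚ./ b
  D = ℕ→ℚ X ℚ.- (+ K ℚ./ k) ℚ.* ℕ→ℚ C
  open +-*-Solver
  -- Multiply ε N ≤ |D| by k b and clear all denominators.
  scaled : ℤ→ℚ (+ (A ℕ.* N ℕ.* k)) ℚ.≤ ℤ→ℚ (+ (ℤ.∣ y ∣ ℕ.* b))
  scaled = begin
    ℤ→ℚ (+ (A ℕ.* N ℕ.* k))
      ≡⟨ trans (ℕ→ℚ-* (A ℕ.* N) k) (cong (ℚ._* ℕ→ℚ k) (ℕ→ℚ-* A N)) ⟩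
    (ℕ→ℚ A ℚ.* ℕ→ℚ N) ℚ.* ℕ→ℚ k
      ≡⟨ cong (λ z → (z ℚ.* ℕ→ℚ N) ℚ.* ℕ→ℚ k) (sym (/-*-cancel (+ A) b-1)) ⟩
    ((ε ℚ.* ℕ→ℚ b) ℚ.* ℕ→ℚ N) ℚ.* ℕ→ℚ k
      ≡⟨ solve 4 (λ e bb nn kk → ((e :* bb) :* nn) :* kk := (e :* nn) :* (kk :* bb)) refl ε (ℕ→ℚ b) (ℕ→ℚ N) (ℕ→ℚ k) ⟩
    (ε ℚ.* ℕ→ℚ N) ℚ.* (ℕ→ℚ k ℚ.* ℕ→ℚ b)
      ≤⟨ ℚP.*-monoʳ-≤-nonNeg (ℕ→ℚ k ℚ.* ℕ→ℚ b) {{kb≥0}} (ℚP.≮⇒≥ not-close) ⟩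
    ℚ.∣ D ∣ ℚ.* (ℕ→ℚ k ℚ.* ℕ→ℚ b)
      ≡⟨ sym (ℚP.*-assoc ℚ.∣ D ∣ (ℕ→ℚ k) (ℕ→ℚ b)) ⟩
    (ℚ.∣ D ∣ ℚ.* ℕ→ℚ k) ℚ.* ℕ→ℚ b
      ≡⟨ cong (λ z → (ℚ.∣ D ∣ ℚ.* z) ℚ.* ℕ→ℚ b) (sym (ℤ→ℚ-∣∣ (+ k))) ⟩
    (ℚ.∣ D ∣ ℚ.* ℚ.∣ ℕ→ℚ k ∣) ℚ.* ℕ→ℚ b
      ≡⟨ cong (ℚ._* ℕ→ℚ b) (trans (sym (ℚP.∣p*q∣≡∣p∣*∣q∣ D (ℕ→ℚ k))) (cong ℚ.∣_∣ (trans (deviation-scaled K X C) (cong ℤ→ℚ y≡)))) ⟩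
    ℚ.∣ ℤ→ℚ y ∣ ℚ.* ℕ→ℚ b
      ≡⟨ trans (cong (ℚ._* ℕ→ℚ b) (ℤ→ℚ-∣∣ y)) (sym (ℕ→ℚ-* ℤ.∣ y ∣ b)) ⟩
    ℤ→ℚ (+ (ℤ.∣ y ∣ ℕ.* b)) ∎
    where
    kb≥0 : ℚ.NonNegative (ℕ→ℚ k ℚ.* ℕ→ℚ b)
    kb≥0 = subst ℚ.NonNegative (ℕ→ℚ-* k b) (ℕ→ℚ-nonNeg (k ℕ.* b))
    open ℚP.≤-Reasoning

few-bad : ∀ K b-1 d-1 bad C T N →
  bad ℕ.* ((N ℕ.* suc K) ℕ.* (N ℕ.* suc K)) ≤ (C ℕ.* (T ℕ.* (K ℕ.* K))) ℕ.* (suc b-1 ℕ.* suc b-1) →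
  C ≤ N → suc d-1 ℕ.* (suc b-1 ℕ.* suc b-1) ≤ N → suc d-1 ℕ.* bad ≤ T
few-bad K b-1 d-1 bad C T N chebyshev C≤N db²≤N = ℕP.*-cancelʳ-≤ (d ℕ.* bad) T w {{w≢0}} (begin
  (d ℕ.* bad) ℕ.* w                     ≡⟨ regroup₁ d bad bb N kk ⟩
  bad ℕ.* ((d ℕ.* bb) ℕ.* (N ℕ.* kk))   ≤⟨ ℕP.*-monoʳ-≤ bad (ℕP.*-monoˡ-≤ (N ℕ.* kk) db²≤N) ⟩
  bad ℕ.* (N ℕ.* (N ℕ.* kk))            ≡⟨ regroup₂ bad N k ⟩
  bad ℕ.* ((N ℕ.* k) ℕ.* (N ℕ.* k))     ≤⟨ chebyshev ⟩
  (C ℕ.* (T ℕ.* (K ℕ.* K))) ℕ.* bb      ≤⟨ ℕP.*-monoˡ-≤ bb (ℕP.*-mono-≤ C≤N (ℕP.*-monoʳ-≤ T K²≤k²)) ⟩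
  (N ℕ.* (T ℕ.* kk)) ℕ.* bb             ≡⟨ regroup₃ N T kk bb ⟩
  T ℕ.* w                               ∎)
  where
  d k bb kk w : ℕ
  d  = suc d-1
  k  = suc K
  bb = suc b-1 ℕ.* suc b-1
  kk = k ℕ.* k
  w  = bb ℕ.* (N ℕ.* kk)
  K²≤k² : K ℕ.* K ≤ kk
  K²≤k² = ℕP.*-mono-≤ (ℕP.n≤1+n K) (ℕP.n≤1+n K)
  instance
    N≢0 : NonZero N
    N≢0 = ℕ.>-nonZero (ℕP.≤-trans (s≤s z≤n) db²≤N)
  w≢0 : NonZero w
  w≢0 = ℕP.m*n≢0 bb (N ℕ.* kk) {{_}} {{ℕP.m*n≢0 N kk}}
  regroup₁ : ∀ d bad bb N kk → (d ℕ.* bad) ℕ.* (bb ℕ.* (N ℕ.* kk)) ≡ bad ℕ.* ((d ℕ.* bb) ℕ.* (N ℕ.* kk))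
  regroup₁ = solve-∀ℕ
  regroup₂ : ∀ bad N k → bad ℕ.* (N ℕ.* (N ℕ.* (k ℕ.* k))) ≡ bad ℕ.* ((N ℕ.* k) ℕ.* (N ℕ.* k))
  regroup₂ = solve-∀ℕ
  regroup₃ : ∀ N T kk bb → (N ℕ.* (T ℕ.* kk)) ℕ.* bb ≡ T ℕ.* (bb ℕ.* (N ℕ.* kk))
  regroup₃ = solve-∀ℕ
  open ℕP.≤-Reasoning

good-fraction : ∀ c-1 d-1 T good bad → good ℕ.+ bad ≡ T → suc d-1 ℕ.* bad ≤ T →
  (ℚ.1ℚ ℚ.- (+ suc c-1 ℚ./ suc d-1)) ℚ.* ℕ→ℚ T ℚ.≤ ℕ→ℚ good
good-fraction c-1 d-1 T good bad partition d*bad≤T = begin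
  (ℚ.1ℚ ℚ.- δ) ℚ.* ℕ→ℚ T                        ≡⟨ split-total ⟩
  ℕ→ℚ good ℚ.+ (ℕ→ℚ bad ℚ.- δ ℚ.* ℕ→ℚ T)       ≤⟨ ℚP.+-monoʳ-≤ (ℕ→ℚ good) (ℚP.+-monoˡ-≤ (ℚ.- (δ ℚ.* ℕ→ℚ T)) bad≤δT) ⟩
  ℕ→ℚ good ℚ.+ (δ ℚ.* ℕ→ℚ T ℚ.- δ ℚ.* ℕ→ℚ T)  ≡⟨ solve 2 (λ g x → g :+ (x :- x) := g) refl (ℕ→ℚ good) (δ ℚ.* ℕ→ℚ T) ⟩
  ℕ→ℚ good                                      ∎
  where
  open +-*-Solver
  open ℚP.≤-Reasoning
  δ : ℚ
  δ = + suc c-1 ℚ./ suc d-1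
  d : ℕ
  d = suc d-1
  T≡ : ℕ→ℚ T ≡ ℕ→ℚ good ℚ.+ ℕ→ℚ bad
  T≡ = trans (cong ℕ→ℚ (sym partition)) (ℤ→ℚ-+ (+ good) (+ bad))
  split-total : (ℚ.1ℚ ℚ.- δ) ℚ.* ℕ→ℚ T ≡ ℕ→ℚ good ℚ.+ (ℕ→ℚ bad ℚ.- δ ℚ.* ℕ→ℚ T)
  split-total = trans (cong ((ℚ.1ℚ ℚ.- δ) ℚ.*_) T≡)
    (trans (solve 3 (λ e g b → (con ℚ.1ℚ :- e) :* (g :+ b) := g :+ (b :- e :* (g :+ b))) refl δ (ℕ→ℚ good) (ℕ→ℚ bad))
      (cong (λ z → ℕ→ℚ good ℚ.+ (ℕ→ℚ bad ℚ.- δ ℚ.* z)) (sym T≡)))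
  -- d · bad ≤ T ≤ c · T = d · (δ T), then cancel d.
  d*bad≤d*δT : ℕ→ℚ d ℚ.* ℕ→ℚ bad ℚ.≤ ℕ→ℚ d ℚ.* (δ ℚ.* ℕ→ℚ T)
  d*bad≤d*δT = begin
    ℕ→ℚ d ℚ.* ℕ→ℚ bad        ≡⟨ sym (ℕ→ℚ-* d bad) ⟩
    ℕ→ℚ (d ℕ.* bad)          ≤⟨ ℤ→ℚ-mono-≤ (+≤+ (ℕP.≤-trans d*bad≤T (ℕP.m≤n*m T (suc c-1)))) ⟩
    ℕ→ℚ (suc c-1 ℕ.* T)      ≡⟨ ℕ→ℚ-* (suc c-1) T ⟩
    ℕ→ℚ (suc c-1) ℚ.* ℕ→ℚ T  ≡⟨ cong (ℚ._* ℕ→ℚ T) (sym (/-*-cancel (+ suc c-1) d-1)) ⟩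
    (δ ℚ.* ℕ→ℚ d) ℚ.* ℕ→ℚ T  ≡⟨ solve 3 (λ x y z → (x :* y) :* z := y :* (x :* z)) refl δ (ℕ→ℚ d) (ℕ→ℚ T) ⟩
    ℕ→ℚ d ℚ.* (δ ℚ.* ℕ→ℚ T)  ∎
  bad≤δT : ℕ→ℚ bad ℚ.≤ δ ℚ.* ℕ→ℚ T
  bad≤δT = ℚP.*-cancelˡ-≤-pos (ℕ→ℚ d) {{ℕ→ℚ-pos d-1}} d*bad≤d*δT

n≤n^[1+m] : ∀ n m → 1 ≤ n → n ≤ n ^ suc m
n≤n^[1+m] n m 1≤n = ℕP.m≤m*n n (n ^ m) {{ℕP.m^n≢0 n m {{ℕ.>-nonZero 1≤n}}}}

-- The theorem for k = K + 2, ε = (a+1)/(b+1) and δ = (c+1)/(d+1), as soon as n ≥ (d+1)(b+1)²: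
-- colourings far from the mean have Y² ≥ (n^k k / b)², the second moment of Y is at most
-- C(n,k) · #colourings · (k−1)², and Chebyshev's counting bound leaves at most a δ fraction.
-- The proof k≢0 is kept abstract so that the conclusion is literally the event of the theorem.
concentration : ∀ K (k≢0 : NonZero (suc (suc K))) (ε δ : ℚ) a b-1 c-1 d-1 →
  ε ≡ + suc a ℚ./ suc b-1 → δ ≡ + suc c-1 ℚ./ suc d-1 →
  ∀ n → suc d-1 ℕ.* (suc b-1 ℕ.* suc b-1) ≤ n → ProbAtLeast (suc (suc K)) n {{k≢0}} ε δ
concentration K k≢0 ε δ a b-1 c-1 d-1 ε≡ δ≡ n n-large =
  subst (λ δ → (ℚ.1ℚ ℚ.- δ) ℚ.* ℕ→ℚ (length (allColorings (suc (suc K)) n))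
                 ℚ.≤ ℕ→ℚ (goodCount (suc (suc K)) n {{k≢0}} ε)) (sym δ≡)
  (good-fraction c-1 d-1 (length (allColorings (suc (suc K)) n)) (goodCount (suc (suc K)) n {{k≢0}} ε) bad
    (length-filter-split close? Colourings)
    (few-bad (suc K) b-1 d-1 bad (n C k) #colourings (n ^ k) (chebyshev (s≤s z≤n) close? (n ^ k ℕ.* k) (suc b-1) far-bound) (C≤^ n k)
      (ℕP.≤-trans n-large (n≤n^[1+m] n (suc K) (ℕP.≤-trans (s≤s z≤n) n-large)))))
  where
  open Hypergraph (suc K) n
  -- The event of the theorem, written exactly as in Defs.goodCount: f is good when the
  -- edge count deviates from p C(n, k) by less than ε n^k.
  deviation : Coloring k n → ℚ
  deviation f = ℚ.∣ ℕ→ℚ (numEdges (suc (suc K)) n {{k≢0}} f) ℚ.- pk (suc (suc K)) {{k≢0}} ℚ.* ℕ→ℚ (n C suc (suc K)) ∣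
  Close : Coloring k n → Set
  Close f = deviation f ℚ.< ε ℚ.* ℕ→ℚ (n ^ suc (suc K))
  close? : Decidable Close
  close? f = deviation f ℚ.<? ε ℚ.* ℕ→ℚ (n ^ suc (suc K))
  bad : ℕ
  bad = length (filter (¬? ∘ close?) Colourings)
  far-bound : ∀ f → ¬ Close f → n ^ k ℕ.* k ≤ ℤ.∣ Y f ∣ ℕ.* suc b-1
  far-bound f far = far-from-mean (suc K) a b-1 (numEdges (suc (suc K)) n {{k≢0}} f) (n C k) (n ^ k) (Y f)
    (Y-counts-edges k≢0 f) (subst (λ ε → ¬ (deviation f ℚ.< ε ℚ.* ℕ→ℚ (n ^ suc (suc K)))) ε≡ far)

lemma19 : (k : ℕ) → (hk : 2 ≤ k) → (ε : ℚ) → Positive ε → (δ : ℚ) → Positive δ →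
    ∃ λ (N : ℕ) → (n : ℕ) → N ≤ n → ProbAtLeast k n {{≥2⇒NonZero hk}} ε δ
lemma19 0             ()
lemma19 1             (s≤s ())
lemma19 (suc (suc K)) hk ε ε>0 δ δ>0 =
  let a , b-1 , ε≡ = positive-fraction ε ε>0
      c-1 , d-1 , δ≡ = positive-fraction δ δ>0
  in suc d-1 ℕ.* (suc b-1 ℕ.* suc b-1) , concentration K (≥2⇒NonZero hk) ε δ a b-1 c-1 d-1 ε≡ δ≡
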